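{- Let $u,v,r,s$ be integers with $\gcd(u,v,r,s)=1$, and let $n=u^4+v^4=r^4+s^4$. If $p$ is an odd prime dividing $n$, then $p\equiv 1\pmod 8$. -}

module Defs where

-- If an odd prime p divides a⁴ + b⁴ but not b, then a⁴ ≡ -b⁴ (mod p), so a⁸ ≡ b⁸ while
-- a⁴ ≢ b⁴: a/b has multiplicative order exactly 8 and 8 ∣ p - 1. Avoiding inverses, write
-- p - 1 = t + 8q; Fermat gives a^(p-1) ≡ 1 ≡ b^(p-1) and a^(8q) ≡ b^(8q), hence a^t ≡ b^t,
-- which for t = 2, 4, 6 leads back to a⁴ ≡ b⁴, while odd t makes p even. Coprimality of
-- u, v, r, s ensures that p misses v or s, so one of the two representations of n applies.
module Submission where

open import Defs
open import Data.Nat using (ℕ; _%_)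
open import Data.Nat.Primality using (Prime)
open import Data.Integer using (ℤ; +_; _+_; _^_)
open import Data.Integer.GCD using (gcd)
open import Data.Integer.Divisibility using (_∣_)
open import Relation.Binary.PropositionalEquality using (_≡_; _≢_)

open import Data.Nat as ℕ using (zero; suc; _∸_; _!; NonZero; NonTrivial; nonTrivial⇒≢1; z<s)
import Data.Nat.Properties as ℕ
import Data.Nat.Divisibility as ℕ
open import Data.Nat.DivMod using (_/_; m/n*n≡m; m%n<n; m≡m%n+[m/n]*n)
open import Data.Nat.Combinatorics using (_C_; nCk≡n!/k![n-k]!; k![n∸k]!∣n!; nCn≡1)
open import Data.Nat.Primality using (euclidsLemma; prime⇒irreducible; prime⇒nonZero; prime⇒nonTrivial)
open import Data.Integer using (-[1+_]; _*_; _-_; -_; 0ℤ; 1ℤ)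
import Data.Integer.Properties as ℤ
open import Data.Integer.GCD using (gcd-greatest)
open import Data.Integer.Divisibility.Signed as Signed
  using (divides; ∣ᵤ⇒∣; ∣⇒∣ᵤ; _∣?_; ∣m∣n⇒∣m+n; ∣m⇒∣-m; ∣m⇒∣m*n; ∣n⇒∣m*n; ∣m+n∣n⇒∣m)
open import Data.Integer.Tactic.RingSolver using (solve-∀)
open import Data.Fin using (Fin; zero; suc; toℕ; inject₁)
open import Data.Fin.Properties using (toℕ-fromℕ; inject₁ℕ<)
open import Data.Vec.Functional using (head; tail; init; last)
import Algebra.Properties.CommutativeSemiring.Binomial ℤ.+-*-commutativeSemiring as Binomial
open import Algebra.Properties.Semiring.Sum ℤ.+-*-semiring using (sum; sum-init-last)
import Algebra.Properties.Semiring.Mult ℤ.+-*-semiring as Mult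
import Algebra.Properties.Semiring.Exp ℤ.+-*-semiring as Exp
open import Data.Empty using (⊥-elim)
open import Data.Sum as Sum using (_⊎_; inj₁; inj₂; [_,_]′)
open import Function using (id; _∘_)
open import Level using (0ℓ)
open import Relation.Binary.Bundles using (Setoid)
open import Relation.Binary.Structures using (IsEquivalence)
open import Relation.Binary.PropositionalEquality using (refl; sym; trans; cong; cong₂; subst)
open import Relation.Nullary using (¬_; yes; no)
import Relation.Binary.Reasoning.Setoid as SetoidReasoning

infix 4 _≡_mod_

-- A record rather than a function so that x and y can be inferred from a congruence proof.
record _≡_mod_ (x y m : ℤ) : Set where
  constructor congruent
  field
    ∣difference : m Signed.∣ x - y

open _≡_mod_

module _ {m : ℤ} where

  ∣⇒≡0-mod : ∀ {x} → m Signed.∣ x → x ≡ 0ℤ mod m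
  ∣⇒≡0-mod {x} m∣x = congruent (subst (m Signed.∣_) (sym (ℤ.+-identityʳ x)) m∣x)

  ≡⇒≡-mod : ∀ {x y} → x ≡ y → x ≡ y mod m
  ≡⇒≡-mod {x} refl = congruent (subst (m Signed.∣_) (sym (ℤ.+-inverseʳ x)) (divides 0ℤ refl))

  ≡-mod-refl : ∀ {x} → x ≡ x mod m
  ≡-mod-refl = ≡⇒≡-mod refl

  ≡-mod-sym : ∀ {x y} → x ≡ y mod m → y ≡ x mod m
  ≡-mod-sym {x} {y} (congruent m∣x-y) =
    congruent (subst (m Signed.∣_) (-[x-y]≡y-x x y) (∣m⇒∣-m m∣x-y))
    where
    -[x-y]≡y-x : ∀ x y → - (x - y) ≡ y - x
    -[x-y]≡y-x = solve-∀

  ≡-mod-trans : ∀ {x y z} → x ≡ y mod m → y ≡ z mod m → x ≡ z mod m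
  ≡-mod-trans {x} {y} {z} (congruent m∣x-y) (congruent m∣y-z) =
    congruent (subst (m Signed.∣_) (x-y+[y-z]≡x-z x y z) (∣m∣n⇒∣m+n m∣x-y m∣y-z))
    where
    x-y+[y-z]≡x-z : ∀ x y z → x - y + (y - z) ≡ x - z
    x-y+[y-z]≡x-z = solve-∀

  +-cong-mod : ∀ {x y u v} → x ≡ y mod m → u ≡ v mod m → x + u ≡ y + v mod m
  +-cong-mod {x} {y} {u} {v} (congruent m∣x-y) (congruent m∣u-v) =
    congruent (subst (m Signed.∣_) (x-y+[u-v]≡x+u-[y+v] x y u v) (∣m∣n⇒∣m+n m∣x-y m∣u-v))
    where
    x-y+[u-v]≡x+u-[y+v] : ∀ x y u v → x - y + (u - v) ≡ x + u - (y + v)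
    x-y+[u-v]≡x+u-[y+v] = solve-∀

  +-congˡ-mod : ∀ x {u v} → u ≡ v mod m → x + u ≡ x + v mod m
  +-congˡ-mod x = +-cong-mod (≡-mod-refl {x})

  +-congʳ-mod : ∀ x {u v} → u ≡ v mod m → u + x ≡ v + x mod m
  +-congʳ-mod x u≡v = +-cong-mod u≡v (≡-mod-refl {x})

  *-cong-mod : ∀ {x y u v} → x ≡ y mod m → u ≡ v mod m → x * u ≡ y * v mod m
  *-cong-mod {x} {y} {u} {v} (congruent m∣x-y) (congruent m∣u-v) =
    congruent (subst (m Signed.∣_) ([x-y]u+y[u-v]≡xu-yv x y u v)
                     (∣m∣n⇒∣m+n (∣m⇒∣m*n u m∣x-y) (∣n⇒∣m*n y m∣u-v)))
    where
    [x-y]u+y[u-v]≡xu-yv : ∀ x y u v → (x - y) * u + y * (u - v) ≡ x * u - y * v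
    [x-y]u+y[u-v]≡xu-yv = solve-∀

  ^-cong-mod : ∀ {x y} → x ≡ y mod m → ∀ k → x ^ k ≡ y ^ k mod m
  ^-cong-mod x≡y zero    = ≡⇒≡-mod refl
  ^-cong-mod x≡y (suc k) = *-cong-mod x≡y (^-cong-mod x≡y k)

  ≡-mod-isEquivalence : IsEquivalence (λ x y → x ≡ y mod m)
  ≡-mod-isEquivalence = record { refl = ≡-mod-refl ; sym = ≡-mod-sym ; trans = ≡-mod-trans }

≡-mod-setoid : ℤ → Setoid 0ℓ 0ℓ
≡-mod-setoid m = record { isEquivalence = ≡-mod-isEquivalence {m} }

module ≡-mod-Reasoning (m : ℤ) = SetoidReasoning (≡-mod-setoid m)

∣-sum : ∀ {m n} (f : Fin n → ℤ) → (∀ i → m Signed.∣ f i) → m Signed.∣ sum f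
∣-sum {n = zero}  f m∣f = divides 0ℤ refl
∣-sum {n = suc n} f m∣f = ∣m∣n⇒∣m+n (m∣f zero) (∣-sum (tail f) (m∣f ∘ suc))

sum≡head+last-mod : ∀ {m n} (f : Fin (suc (suc n)) → ℤ) →
                    (∀ i → m Signed.∣ f (suc (inject₁ i))) →
                    sum f ≡ head f + last f mod m
sum≡head+last-mod {m} f m∣inner = begin
  sum f                                    ≡⟨ cong (_+_ (head f)) (sum-init-last (tail f)) ⟩
  head f + (sum (init (tail f)) + last f)  ≈⟨ +-congˡ-mod (head f) (+-congʳ-mod (last f) inner≡0) ⟩
  head f + (0ℤ + last f)                   ≡⟨ cong (_+_ (head f)) (ℤ.+-identityˡ (last f)) ⟩
  head f + last f                          ∎
  where
  open ≡-mod-Reasoning m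
  inner≡0 : sum (init (tail f)) ≡ 0ℤ mod m
  inner≡0 = ∣⇒≡0-mod (∣-sum (init (tail f)) m∣inner)

×≡* : ∀ n x → n Mult.× x ≡ + n * x
×≡* zero    x = sym (ℤ.*-zeroˡ x)
×≡* (suc n) x = trans (cong (_+_ x) (×≡* n x)) (sym (ℤ.suc-* (+ n) x))

^≡^ : ∀ x n → x Exp.^ n ≡ x ^ n
^≡^ x zero    = refl
^≡^ x (suc n) = cong (x *_) (^≡^ x n)

freshmansDream-mod : ∀ {m} n → .{{NonZero n}} →
                     (∀ {k} → 0 ℕ.< k → k ℕ.< n → m Signed.∣ + (n C k)) →
                     ∀ x y → (x + y) ^ n ≡ x ^ n + y ^ n mod m
freshmansDream-mod {m} (suc n) m∣nCk x y = begin
  (x + y) ^ suc n        ≡⟨ sym (^≡^ (x + y) (suc n)) ⟩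
  (x + y) Exp.^ suc n    ≡⟨ Binomial.theorem (suc n) x y ⟩
  sum term               ≈⟨ sum≡head+last-mod term m∣inner ⟩
  head term + last term  ≡⟨ cong₂ _+_ head≡y^n last≡x^n ⟩
  y ^ suc n + x ^ suc n  ≡⟨ ℤ.+-comm (y ^ suc n) (x ^ suc n) ⟩
  x ^ suc n + y ^ suc n  ∎
  where
  open ≡-mod-Reasoning m
  term : Fin (suc (suc n)) → ℤ
  term = Binomial.binomialTerm x y (suc n)
  head≡y^n : head term ≡ y ^ suc n
  head≡y^n = trans (Mult.×-homo-1 _) (trans (ℤ.*-identityˡ _) (^≡^ y (suc n)))
  last≡x^n : last term ≡ x ^ suc n
  last≡x^n rewrite toℕ-fromℕ n | nCn≡1 (suc n) | ℕ.n∸n≡0 n =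
    trans (Mult.×-homo-1 _) (trans (ℤ.*-identityʳ _) (^≡^ x (suc n)))
  m∣inner : ∀ i → m Signed.∣ term (suc (inject₁ i))
  m∣inner i = subst (m Signed.∣_) (sym (×≡* (suc n C k) _))
                    (∣m⇒∣m*n _ (m∣nCk z<s (ℕ.s≤s (inject₁ℕ< i))))
    where
    k = toℕ (suc (inject₁ i))

^-*-cong-mod : ∀ {m x y} k → x ^ k ≡ y ^ k mod m → ∀ q → x ^ (q ℕ.* k) ≡ y ^ (q ℕ.* k) mod m
^-*-cong-mod {m} {x} {y} k x^k≡y^k q = begin
  x ^ (q ℕ.* k)  ≡⟨ x^[q*k]≡[x^k]^q x ⟩
  (x ^ k) ^ q    ≈⟨ ^-cong-mod x^k≡y^k q ⟩
  (y ^ k) ^ q    ≡⟨ x^[q*k]≡[x^k]^q y ⟨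
  y ^ (q ℕ.* k)  ∎
  where
  open ≡-mod-Reasoning m
  x^[q*k]≡[x^k]^q : ∀ x → x ^ (q ℕ.* k) ≡ (x ^ k) ^ q
  x^[q*k]≡[x^k]^q x = trans (cong (x ^_) (ℕ.*-comm q k)) (sym (ℤ.^-*-assoc x k q))

∣⇒∣gcd : ∀ {k i j} → k Signed.∣ i → k Signed.∣ j → k Signed.∣ gcd i j
∣⇒∣gcd {k} {i} {j} k∣i k∣j = ∣ᵤ⇒∣ (gcd-greatest {i} {j} {k} (∣⇒∣ᵤ k∣i) (∣⇒∣ᵤ k∣j))

n∣n! : ∀ n → .{{NonZero n}} → n ℕ.∣ n !
n∣n! (suc n) = ℕ.m∣m*n (n !)

nCk*k![n∸k]!≡n! : ∀ {n k} → k ℕ.≤ n → (n C k) ℕ.* (k ! ℕ.* (n ∸ k) !) ≡ n !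
nCk*k![n∸k]!≡n! {n} {k} k≤n = trans (cong (ℕ._* (k ! ℕ.* (n ∸ k) !)) (nCk≡n!/k![n-k]! k≤n))
                                    (m/n*n≡m {{ℕ._!*_!≢0 k (n ∸ k)}} (k![n∸k]!∣n! k≤n))

module _ {p : ℕ} (p-prime : Prime p) where

  private instance
    p-nonZero : NonZero p
    p-nonZero = prime⇒nonZero p-prime
    p-nonTrivial : NonTrivial p
    p-nonTrivial = prime⇒nonTrivial p-prime

  open ≡-mod-Reasoning (+ p)

  prime∤1 : ¬ p ℕ.∣ 1
  prime∤1 p∣1 = nonTrivial⇒≢1 (ℕ.∣1⇒≡1 p∣1)

  prime∤m! : ∀ {m} → m ℕ.< p → ¬ p ℕ.∣ m !
  prime∤m! {zero}  _   p∣1     = prime∤1 p∣1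
  prime∤m! {suc m} m<p p∣[1+m]! with euclidsLemma (suc m) (m !) p-prime p∣[1+m]!
  ... | inj₁ p∣1+m = ℕ.<⇒≱ m<p (ℕ.∣⇒≤ p∣1+m)
  ... | inj₂ p∣m!  = prime∤m! (ℕ.<-trans (ℕ.n<1+n m) m<p) p∣m!

  prime∣pCk : ∀ {k} → 0 ℕ.< k → k ℕ.< p → p ℕ.∣ p C k
  prime∣pCk {k} 0<k k<p = [ id , ⊥-elim ∘ p∤k![p∸k]! ]′ (euclidsLemma _ _ p-prime p∣pCk*k![p∸k]!)
    where
    p∣pCk*k![p∸k]! : p ℕ.∣ (p C k) ℕ.* (k ! ℕ.* (p ∸ k) !)
    p∣pCk*k![p∸k]! = subst (p ℕ.∣_) (sym (nCk*k![n∸k]!≡n! (ℕ.<⇒≤ k<p))) (n∣n! p)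
    p∤k![p∸k]! : ¬ p ℕ.∣ k ! ℕ.* (p ∸ k) !
    p∤k![p∸k]! p∣k![p∸k]! = [ prime∤m! k<p , prime∤m! (ℕ.∸-monoʳ-< 0<k (ℕ.<⇒≤ k<p)) ]′
                              (euclidsLemma _ _ p-prime p∣k![p∸k]!)

  prime∣*⇒∣⊎∣ : ∀ {a b} → + p Signed.∣ a * b → + p Signed.∣ a ⊎ + p Signed.∣ b
  prime∣*⇒∣⊎∣ {a} {b} p∣ab =
    Sum.map ∣ᵤ⇒∣ ∣ᵤ⇒∣ (euclidsLemma _ _ p-prime (subst (p ℕ.∣_) (ℤ.abs-* a b) (∣⇒∣ᵤ p∣ab)))

  prime∣^⇒∣ : ∀ {a} k → + p Signed.∣ a ^ k → + p Signed.∣ a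
  prime∣^⇒∣ zero    p∣1       = ⊥-elim (prime∤1 (∣⇒∣ᵤ p∣1))
  prime∣^⇒∣ (suc k) p∣a^[1+k] = [ id , prime∣^⇒∣ k ]′ (prime∣*⇒∣⊎∣ p∣a^[1+k])

  ∣xⁿ+yⁿ∧∣y⇒∣x : ∀ {x y} n → + p Signed.∣ x ^ suc n + y ^ suc n →
                 + p Signed.∣ y → + p Signed.∣ x
  ∣xⁿ+yⁿ∧∣y⇒∣x {y = y} n p∣xⁿ+yⁿ p∣y =
    prime∣^⇒∣ (suc n) (∣m+n∣n⇒∣m p∣xⁿ+yⁿ (∣m⇒∣m*n (y ^ n) p∣y))

  *-cancelˡ-mod-prime : ∀ {c x y} → ¬ + p Signed.∣ c → c * x ≡ c * y mod + p → x ≡ y mod + p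
  *-cancelˡ-mod-prime {c} {x} {y} p∤c (congruent p∣cx-cy) = congruent
    ([ ⊥-elim ∘ p∤c , id ]′ (prime∣*⇒∣⊎∣ (subst (+ p Signed.∣_) (cx-cy≡c[x-y] c x y) p∣cx-cy)))
    where
    cx-cy≡c[x-y] : ∀ c x y → c * x - c * y ≡ c * (x - y)
    cx-cy≡c[x-y] = solve-∀

  0^p≡0 : 0ℤ ^ p ≡ 0ℤ
  0^p≡0 = cong (0ℤ ^_) (sym (ℕ.suc-pred p))

  freshmansDream-mod-prime : ∀ x y → (x + y) ^ p ≡ x ^ p + y ^ p mod + p
  freshmansDream-mod-prime = freshmansDream-mod p (λ 0<k k<p → ∣ᵤ⇒∣ (prime∣pCk 0<k k<p))

  fermatsLittleTheorem : ∀ a → a ^ p ≡ a mod + p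
  fermatsLittleTheorem (+ n)    = fermat⁺ n
    where
    fermat⁺ : ∀ n → (+ n) ^ p ≡ + n mod + p
    fermat⁺ zero    = ≡⇒≡-mod 0^p≡0
    fermat⁺ (suc n) = begin
      (1ℤ + + n) ^ p       ≈⟨ freshmansDream-mod-prime 1ℤ (+ n) ⟩
      1ℤ ^ p + (+ n) ^ p   ≈⟨ +-cong-mod (≡⇒≡-mod (ℤ.^-zeroˡ p)) (fermat⁺ n) ⟩
      1ℤ + + n             ∎
  fermatsLittleTheorem a@(-[1+ n ]) = begin
    a ^ p                  ≡⟨ x≡x+[-a]+a (a ^ p) a ⟩
    a ^ p + (- a) + a      ≈⟨ +-congʳ-mod a (+-congˡ-mod (a ^ p) (≡-mod-sym (fermatsLittleTheorem (- a)))) ⟩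
    a ^ p + (- a) ^ p + a  ≈⟨ +-congʳ-mod a (≡-mod-sym (freshmansDream-mod-prime a (- a))) ⟩
    (a - a) ^ p + a        ≡⟨ cong (λ z → z ^ p + a) (ℤ.+-inverseʳ a) ⟩
    0ℤ ^ p + a             ≡⟨ cong (_+ a) 0^p≡0 ⟩
    0ℤ + a                 ≡⟨ ℤ.+-identityˡ a ⟩
    a                      ∎
    where
    x≡x+[-a]+a : ∀ x a → x ≡ x + (- a) + a
    x≡x+[-a]+a = solve-∀

  fermatsLittleTheorem′ : ∀ {a} → ¬ + p Signed.∣ a → a ^ ℕ.pred p ≡ 1ℤ mod + p
  fermatsLittleTheorem′ {a} p∤a = *-cancelˡ-mod-prime p∤a (begin
    a * a ^ ℕ.pred p  ≡⟨ cong (a ^_) (ℕ.suc-pred p) ⟩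
    a ^ p             ≈⟨ fermatsLittleTheorem a ⟩
    a                 ≡⟨ ℤ.*-identityʳ a ⟨
    a * 1ℤ            ∎)

  ^-cancel-mod-prime : ∀ {a b} k m → ¬ + p Signed.∣ b → a ^ m ≡ b ^ m mod + p →
                       a ^ (k ℕ.+ m) ≡ b ^ (k ℕ.+ m) mod + p → a ^ k ≡ b ^ k mod + p
  ^-cancel-mod-prime {a} {b} k m p∤b a^m≡b^m a^[k+m]≡b^[k+m] =
    *-cancelˡ-mod-prime (p∤b ∘ prime∣^⇒∣ m) (begin
      b ^ m * a ^ k    ≡⟨ ℤ.*-comm (b ^ m) (a ^ k) ⟩
      a ^ k * b ^ m    ≈⟨ *-cong-mod (≡-mod-refl {x = a ^ k}) (≡-mod-sym a^m≡b^m) ⟩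
      a ^ k * a ^ m    ≡⟨ ℤ.^-distribˡ-+-* a k m ⟨
      a ^ (k ℕ.+ m)    ≈⟨ a^[k+m]≡b^[k+m] ⟩
      b ^ (k ℕ.+ m)    ≡⟨ ℤ.^-distribˡ-+-* b k m ⟩
      b ^ k * b ^ m    ≡⟨ ℤ.*-comm (b ^ k) (b ^ m) ⟩
      b ^ m * b ^ k    ∎)

module _ {p : ℕ} (p-prime : Prime p) (p≢2 : p ≢ 2) (a b : ℤ)
         (p∣a⁴+b⁴ : + p Signed.∣ a ^ 4 + b ^ 4) (p∤b : ¬ + p Signed.∣ b) where

  open ≡-mod-Reasoning (+ p)

  private
    p∤a : ¬ + p Signed.∣ a
    p∤a = p∤b ∘ ∣xⁿ+yⁿ∧∣y⇒∣x p-prime 3 p∣b⁴+a⁴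
      where
      p∣b⁴+a⁴ : + p Signed.∣ b ^ 4 + a ^ 4
      p∣b⁴+a⁴ = subst (+ p Signed.∣_) (ℤ.+-comm (a ^ 4) (b ^ 4)) p∣a⁴+b⁴

    a⁴≡-b⁴ : a ^ 4 ≡ - b ^ 4 mod + p
    a⁴≡-b⁴ = congruent (subst (+ p Signed.∣_) (x+y≡x-[-y] (a ^ 4) (b ^ 4)) p∣a⁴+b⁴)
      where
      x+y≡x-[-y] : ∀ x y → x + y ≡ x - (- y)
      x+y≡x-[-y] = solve-∀

    a⁸≡b⁸ : a ^ 8 ≡ b ^ 8 mod + p
    a⁸≡b⁸ = begin
      a ^ 8                  ≡⟨ ℤ.^-distribˡ-+-* a 4 4 ⟩
      a ^ 4 * a ^ 4          ≈⟨ *-cong-mod a⁴≡-b⁴ a⁴≡-b⁴ ⟩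
      (- b ^ 4) * (- b ^ 4)  ≡⟨ [-x][-x]≡xx (b ^ 4) ⟩
      b ^ 4 * b ^ 4          ≡⟨ ℤ.^-distribˡ-+-* b 4 4 ⟨
      b ^ 8                  ∎
      where
      [-x][-x]≡xx : ∀ x → (- x) * (- x) ≡ x * x
      [-x][-x]≡xx = solve-∀

    a⁴≢b⁴ : ¬ a ^ 4 ≡ b ^ 4 mod + p
    a⁴≢b⁴ a⁴≡b⁴ = [ p≢2 ∘ prime∣2⇒≡2 , p∤b ∘ prime∣^⇒∣ p-prime 4 ]′ (prime∣*⇒∣⊎∣ p-prime p∣2b⁴)
      where
      p∣2b⁴ : + p Signed.∣ + 2 * b ^ 4
      p∣2b⁴ = subst (+ p Signed.∣_) (x-[-x]≡2x (b ^ 4))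
                    (∣difference (≡-mod-trans (≡-mod-sym a⁴≡b⁴) a⁴≡-b⁴))
        where
        x-[-x]≡2x : ∀ x → x - (- x) ≡ + 2 * x
        x-[-x]≡2x = solve-∀
      prime∣2⇒≡2 : + p Signed.∣ + 2 → p ≡ 2
      prime∣2⇒≡2 p∣2 =
        ℕ.≤-antisym (ℕ.∣⇒≤ (∣⇒∣ᵤ p∣2)) (ℕ.nonTrivial⇒n>1 p {{prime⇒nonTrivial p-prime}})

    a²≢b² : ¬ a ^ 2 ≡ b ^ 2 mod + p
    a²≢b² a²≡b² = a⁴≢b⁴ (^-*-cong-mod {x = a} {y = b} 2 a²≡b² 2)

    a⁶≢b⁶ : ¬ a ^ 6 ≡ b ^ 6 mod + p
    a⁶≢b⁶ a⁶≡b⁶ = a²≢b² (^-cancel-mod-prime p-prime {a} 2 6 p∤b a⁶≡b⁶ a⁸≡b⁸)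

    a^t≡b^t : ∀ t q → p ≡ suc (t ℕ.+ q ℕ.* 8) → a ^ t ≡ b ^ t mod + p
    a^t≡b^t t q p≡1+t+8q =
      ^-cancel-mod-prime p-prime {a} t (q ℕ.* 8) p∤b (^-*-cong-mod {x = a} 8 a⁸≡b⁸ q) (begin
        a ^ (t ℕ.+ q ℕ.* 8)  ≡⟨ cong (a ^_) p-1≡t+8q ⟨
        a ^ ℕ.pred p         ≈⟨ fermatsLittleTheorem′ p-prime p∤a ⟩
        1ℤ                   ≈⟨ fermatsLittleTheorem′ p-prime p∤b ⟨
        b ^ ℕ.pred p         ≡⟨ cong (b ^_) p-1≡t+8q ⟩
        b ^ (t ℕ.+ q ℕ.* 8)  ∎)
      where
      p-1≡t+8q : ℕ.pred p ≡ t ℕ.+ q ℕ.* 8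
      p-1≡t+8q = cong ℕ.pred p≡1+t+8q

    p≢even+8q : ∀ {r} q → 2 ℕ.∣ r → p ≢ r ℕ.+ q ℕ.* 8
    p≢even+8q q 2∣r p≡r+8q = [ (λ ()) , p≢2 ∘ sym ]′ (prime⇒irreducible p-prime 2∣p)
      where
      2∣p : 2 ℕ.∣ p
      2∣p = subst (2 ℕ.∣_) (sym p≡r+8q)
                  (ℕ.∣m∣n⇒∣m+n 2∣r (ℕ.∣-trans (ℕ.divides 4 refl) (ℕ.n∣m*n q)))

    residue≡1 : ∀ r q → r ℕ.< 8 → p ≡ r ℕ.+ q ℕ.* 8 → r ≡ 1
    residue≡1 0 q _ p≡r+8q = ⊥-elim (p≢even+8q q (ℕ.divides 0 refl) p≡r+8q)
    residue≡1 1 q _ p≡r+8q = refl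
    residue≡1 2 q _ p≡r+8q = ⊥-elim (p≢even+8q q (ℕ.divides 1 refl) p≡r+8q)
    residue≡1 3 q _ p≡r+8q = ⊥-elim (a²≢b² (a^t≡b^t 2 q p≡r+8q))
    residue≡1 4 q _ p≡r+8q = ⊥-elim (p≢even+8q q (ℕ.divides 2 refl) p≡r+8q)
    residue≡1 5 q _ p≡r+8q = ⊥-elim (a⁴≢b⁴ (a^t≡b^t 4 q p≡r+8q))
    residue≡1 6 q _ p≡r+8q = ⊥-elim (p≢even+8q q (ℕ.divides 3 refl) p≡r+8q)
    residue≡1 7 q _ p≡r+8q = ⊥-elim (a⁶≢b⁶ (a^t≡b^t 6 q p≡r+8q))
    residue≡1 (suc (suc (suc (suc (suc (suc (suc (suc r)))))))) q 8+r<8 _ =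
      ⊥-elim (ℕ.<⇒≱ 8+r<8 (ℕ.m≤m+n 8 r))

  odd-prime∣a⁴+b⁴⇒p%8≡1 : p % 8 ≡ 1
  odd-prime∣a⁴+b⁴⇒p%8≡1 = residue≡1 (p % 8) (p / 8) (m%n<n p 8) (m≡m%n+[m/n]*n p 8)

proposition3p1 : (u v r s : ℤ) → gcd (gcd (gcd u v) r) s ≡ + 1 →
                 (n : ℤ) → n ≡ u ^ 4 + v ^ 4 → n ≡ r ^ 4 + s ^ 4 →
                 (p : ℕ) → Prime p → p ≢ 2 → + p ∣ n →
                 p % 8 ≡ 1
proposition3p1 u v r s gcd≡1 n n≡u⁴+v⁴ n≡r⁴+s⁴ p p-prime p≢2 p∣n =
  [ odd-prime∣a⁴+b⁴⇒p%8≡1 p-prime p≢2 u v p∣u⁴+v⁴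
  , odd-prime∣a⁴+b⁴⇒p%8≡1 p-prime p≢2 r s p∣r⁴+s⁴
  ]′ p∤v⊎p∤s
  where
  p∣u⁴+v⁴ : + p Signed.∣ u ^ 4 + v ^ 4
  p∣u⁴+v⁴ = subst (+ p Signed.∣_) n≡u⁴+v⁴ (∣ᵤ⇒∣ p∣n)
  p∣r⁴+s⁴ : + p Signed.∣ r ^ 4 + s ^ 4
  p∣r⁴+s⁴ = subst (+ p Signed.∣_) n≡r⁴+s⁴ (∣ᵤ⇒∣ p∣n)
  p∤v⊎p∤s : ¬ + p Signed.∣ v ⊎ ¬ + p Signed.∣ s
  p∤v⊎p∤s with + p ∣? v | + p ∣? s
  ... | no p∤v  | _       = inj₁ p∤v
  ... | yes _   | no p∤s  = inj₂ p∤s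
  ... | yes p∣v | yes p∣s = ⊥-elim (prime∤1 p-prime (∣⇒∣ᵤ (subst (+ p Signed.∣_) gcd≡1 p∣gcd)))
    where
    p∣gcd : + p Signed.∣ gcd (gcd (gcd u v) r) s
    p∣gcd = ∣⇒∣gcd (∣⇒∣gcd (∣⇒∣gcd p∣u p∣v) p∣r) p∣s
      where
      p∣u : + p Signed.∣ u
      p∣u = ∣xⁿ+yⁿ∧∣y⇒∣x p-prime 3 p∣u⁴+v⁴ p∣v
      p∣r : + p Signed.∣ r
      p∣r = ∣xⁿ+yⁿ∧∣y⇒∣x p-prime 3 p∣r⁴+s⁴ p∣s
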